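{- For each graph $H$ among $C_3$, $2K_2$, $P_4$, $C_4$, $C_3+e$, $K_4-e$, $P_2\cup P_3$, $S_{1,2}$, $P_5$, $C_3+e+e$, $C_3+2e$, $C_4+e$, $S_{2,2}$, and $S_k$ for any $k\ge 2$, there are infinitely many pairwise non-isomorphic subcubic graphs $G$ each having a connected coalition partition $\pi$ with $CCG(G,\pi)\cong H$.
   Context: All graphs are finite and simple. A graph is subcubic if it is connected and its maximum vertex degree is at most 3. For a graph $G$ with vertex set $V$ and $S\subseteq V$, $G[S]$ denotes the induced subgraph. A set $D\subseteq V$ is dominating if every vertex of $V\setminus D$ has a neighbour in $D$; it is a connected dominating set if moreover $G[D]$ is connected. Two disjoint subsets $A,B\subseteq V$ form a connected coalition if neither $A$ nor $B$ is a connected dominating set but $A\cup B$ is a connected dominating set. A connected coalition partition of $G$ is a partition $\pi=\{V_1,\dots,V_k\}$ of $V$ such that each $V_i$ either is a connected dominating set consisting of a single vertex, or forms a connected coalition with some set of $\pi$. The coalition graph $CCG(G,\pi)$ has vertex set $\{V_1,\dots,V_k\}$, with $V_i$ and $V_j$ adjacent if and only if they form a connected coalition in $G$. Notation: $S_n$ is the star of order $n$ ($K_{1,n-1}$); $2K_2$ is two disjoint edges; $P_2\cup P_3$ is the disjoint union of $P_2$ and $P_3$; $K_4-e$ is $K_4$ minus one edge; $C_3+e$ is a triangle with one pendant vertex attached; $C_3+2e$ is a triangle with two pendant vertices attached to the same triangle vertex; $C_3+e+e$ is a triangle with two pendant vertices attached to two different triangle vertices; $C_4+e$ is a 4-cycle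 with one pendant vertex attached; $S_{1,2}$ is the unique 5-vertex tree other than $P_5$ and $S_5$; $S_{2,2}$ is the double star on 6 vertices: two adjacent vertices each having exactly two further pendant neighbours. -}

module Defs where

open import Data.Nat using (ℕ; zero; suc; _≤_)
open import Data.Fin using (Fin; zero; suc; _≟_; #_)
open import Data.Unit using (⊤)

open import Data.Bool using (Bool; true; false; not; _∧_; _∨_)
open import Data.Bool.Properties using (∨-comm)
open import Data.List using (List; []; _∷_; length; filterᵇ; allFin; any)
open import Data.Product using (Σ; ∃; _×_; _,_; proj₁)
open import Data.Sum using (_⊎_)
open import Data.Empty using (⊥)
open import Relation.Nullary using (¬_; yes; no)
open import Relation.Nullary.Decidable using (⌊_⌋)
open import Relation.Binary.PropositionalEquality using (_≡_; _≢_; refl; sym; cong; cong₂)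
open import Function.Bundles using (_↔_; _⇔_; Inverse)

record Graph : Set where
  field
    n       : ℕ
    adj     : Fin n → Fin n → Bool
    adj-sym : ∀ u v → adj u v ≡ adj v u
    adj-irr : ∀ v → adj v v ≡ false
open Graph public

V : Graph → Set
V G = Fin (n G)

Adj : (G : Graph) → V G → V G → Set
Adj G u v = adj G u v ≡ true

deg : (G : Graph) → V G → ℕ
deg G v = length (filterᵇ (adj G v) (allFin (n G)))

_≅_ : Graph → Graph → Set
G ≅ H = Σ (V G ↔ V H) λ σ →
  ∀ u v → adj G u v ≡ adj H (Inverse.to σ u) (Inverse.to σ v)

VSet : Graph → Set₁
VSet G = V G → Set

_∪ˢ_ : {G : Graph} → VSet G → VSet G → VSet G
(A ∪ˢ B) v = A v ⊎ B v

Disjoint : {G : Graph} → VSet G → VSet G → Set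
Disjoint {G} A B = ∀ v → A v → B v → ⊥

IsSingleton : {G : Graph} → VSet G → Set
IsSingleton {G} A = ∃ λ v → ∀ u → A u ⇔ (u ≡ v)

Dominating : (G : Graph) → VSet G → Set
Dominating G D = ∀ v → ¬ D v → ∃ λ u → D u × Adj G u v

data WalkIn (G : Graph) (D : VSet G) : V G → V G → Set where
  here : ∀ {u} → D u → WalkIn G D u u
  step : ∀ {u w v} → D u → Adj G u w → WalkIn G D w v → WalkIn G D u v

InducedConnected : (G : Graph) → VSet G → Set
InducedConnected G D = ∀ u v → D u → D v → WalkIn G D u v

ConnectedDominating : (G : Graph) → VSet G → Set
ConnectedDominating G D = Dominating G D × InducedConnected G D

ConnCoalition : (G : Graph) → VSet G → VSet G → Set
ConnCoalition G A B =
  Disjoint {G} A B × ¬ ConnectedDominating G A × ¬ ConnectedDominating G B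
  × ConnectedDominating G (_∪ˢ_ {G} A B)

Connected : Graph → Set
Connected G = InducedConnected G (λ _ → ⊤)

Subcubic : Graph → Set
Subcubic G = (1 ≤ n G) × Connected G × (∀ v → deg G v ≤ 3)

-- Partitions into k nonempty classes are given by a surjective
-- class-assignment map π : V G → Fin k; class i is V_i = π⁻¹(i).

Class : (G : Graph) {k : ℕ} → (V G → Fin k) → Fin k → VSet G
Class G π i v = π v ≡ i

IsPartition : (G : Graph) {k : ℕ} → (V G → Fin k) → Set
IsPartition G {k} π = ∀ (i : Fin k) → ∃ λ v → π v ≡ i

IsConnCoalitionPartition : (G : Graph) {k : ℕ} → (V G → Fin k) → Set
IsConnCoalitionPartition G {k} π =
  IsPartition G π ×
  (∀ (i : Fin k) →
     (IsSingleton {G} (Class G π i) × ConnectedDominating G (Class G π i))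
     ⊎ (∃ λ (j : Fin k) → ConnCoalition G (Class G π i) (Class G π j)))

CCG≅ : (G : Graph) {k : ℕ} → (V G → Fin k) → Graph → Set
CCG≅ G {k} π H = Σ (Fin k ↔ V H) λ σ →
  ∀ i j → ConnCoalition G (Class G π i) (Class G π j)
          ⇔ Adj H (Inverse.to σ i) (Inverse.to σ j)

HasCCPWithCCG : Graph → Graph → Set
HasCCPWithCCG G H = Σ ℕ λ k → Σ (V G → Fin k) λ π →
  IsConnCoalitionPartition G π × CCG≅ G π H

InfinitelyManyRealise : Graph → Set
InfinitelyManyRealise H = Σ (ℕ → Graph) λ f →
  (∀ i → Subcubic (f i) × HasCCPWithCCG (f i) H) ×
  (∀ i j → i ≢ j → ¬ (f i ≅ f j))

private
  eqB : ∀ {m} → Fin m → Fin m → Bool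
  eqB u v = ⌊ u ≟ v ⌋

  eqB-refl : ∀ {m} (v : Fin m) → eqB v v ≡ true
  eqB-refl v with v ≟ v
  ... | yes _ = refl
  ... | no ¬p = Data.Empty.⊥-elim (¬p refl)
    where import Data.Empty

  eqB-sym : ∀ {m} (u v : Fin m) → eqB u v ≡ eqB v u
  eqB-sym u v with u ≟ v | v ≟ u
  ... | yes _ | yes _ = refl
  ... | no _  | no _  = refl
  ... | yes p | no ¬q = Data.Empty.⊥-elim (¬q (sym p))
    where import Data.Empty
  ... | no ¬p | yes q = Data.Empty.⊥-elim (¬p (sym q))
    where import Data.Empty

  edgeB : ∀ {m} → Fin m → Fin m → Fin m × Fin m → Bool
  edgeB u v (a , b) = (eqB u a ∧ eqB v b) ∨ (eqB u b ∧ eqB v a)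

  edgeB-sym : ∀ {m} (u v : Fin m) e → edgeB u v e ≡ edgeB v u e
  edgeB-sym u v (a , b) = ∨-comm (eqB u a ∧ eqB v b) (eqB u b ∧ eqB v a)
    ⟨trans⟩ cong₂ _∨_ (∧-comm' (eqB u b) (eqB v a)) (∧-comm' (eqB u a) (eqB v b))
    where
    open import Data.Bool.Properties using (∧-comm)
    open import Relation.Binary.PropositionalEquality using () renaming (trans to _⟨trans⟩_)
    ∧-comm' = ∧-comm

  anyE : ∀ {m} → (Fin m × Fin m → Bool) → List (Fin m × Fin m) → Bool
  anyE p [] = false
  anyE p (e ∷ es) = p e ∨ anyE p es

  anyE-sym : ∀ {m} (u v : Fin m) es → anyE (edgeB u v) es ≡ anyE (edgeB v u) es
  anyE-sym u v [] = refl
  anyE-sym u v (e ∷ es) = cong₂ _∨_ (edgeB-sym u v e) (anyE-sym u v es)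

fromEdges : (m : ℕ) → List (Fin m × Fin m) → Graph
fromEdges m es = record
  { n = m
  ; adj = λ u v → not (eqB u v) ∧ anyE (edgeB u v) es
  ; adj-sym = λ u v → cong₂ (λ x y → not x ∧ y) (eqB-sym u v) (anyE-sym u v es)
  ; adj-irr = λ v → cong (λ x → not x ∧ anyE (edgeB v v) es) (eqB-refl v)
  }

C3 TwoK2 P4 C4 C3+e K4-e P2∪P3 S12 P5 C3+e+e C3+2e C4+e S22 : Graph
C3     = fromEdges 3 ((# 0 , # 1) ∷ (# 1 , # 2) ∷ (# 2 , # 0) ∷ [])
TwoK2  = fromEdges 4 ((# 0 , # 1) ∷ (# 2 , # 3) ∷ [])
P4     = fromEdges 4 ((# 0 , # 1) ∷ (# 1 , # 2) ∷ (# 2 , # 3) ∷ [])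
C4     = fromEdges 4 ((# 0 , # 1) ∷ (# 1 , # 2) ∷ (# 2 , # 3) ∷ (# 3 , # 0) ∷ [])
C3+e   = fromEdges 4 ((# 0 , # 1) ∷ (# 1 , # 2) ∷ (# 2 , # 0) ∷ (# 0 , # 3) ∷ [])
K4-e   = fromEdges 4 ((# 0 , # 1) ∷ (# 0 , # 2) ∷ (# 0 , # 3) ∷ (# 1 , # 2) ∷ (# 1 , # 3) ∷ [])
P2∪P3  = fromEdges 5 ((# 0 , # 1) ∷ (# 2 , # 3) ∷ (# 3 , # 4) ∷ [])
S12    = fromEdges 5 ((# 0 , # 1) ∷ (# 0 , # 2) ∷ (# 0 , # 3) ∷ (# 3 , # 4) ∷ [])
P5     = fromEdges 5 ((# 0 , # 1) ∷ (# 1 , # 2) ∷ (# 2 , # 3) ∷ (# 3 , # 4) ∷ [])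
C3+e+e = fromEdges 5 ((# 0 , # 1) ∷ (# 1 , # 2) ∷ (# 2 , # 0) ∷ (# 0 , # 3) ∷ (# 1 , # 4) ∷ [])
C3+2e  = fromEdges 5 ((# 0 , # 1) ∷ (# 1 , # 2) ∷ (# 2 , # 0) ∷ (# 0 , # 3) ∷ (# 0 , # 4) ∷ [])
C4+e   = fromEdges 5 ((# 0 , # 1) ∷ (# 1 , # 2) ∷ (# 2 , # 3) ∷ (# 3 , # 0) ∷ (# 0 , # 4) ∷ [])
S22    = fromEdges 6 ((# 0 , # 1) ∷ (# 0 , # 2) ∷ (# 0 , # 3) ∷ (# 1 , # 4) ∷ (# 1 , # 5) ∷ [])

-- The star S_k = K_{1,k-1} of order k, centre 0.
private
  starAdj : ∀ {k} → Fin k → Fin k → Bool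
  starAdj zero    zero    = false
  starAdj zero    (suc _) = true
  starAdj (suc _) zero    = true
  starAdj (suc _) (suc _) = false

  starAdj-sym : ∀ {k} (u v : Fin k) → starAdj u v ≡ starAdj v u
  starAdj-sym zero    zero    = refl
  starAdj-sym zero    (suc _) = refl
  starAdj-sym (suc _) zero    = refl
  starAdj-sym (suc _) (suc _) = refl

  starAdj-irr : ∀ {k} (v : Fin k) → starAdj v v ≡ false
  starAdj-irr zero    = refl
  starAdj-irr (suc _) = refl

Star : ℕ → Graph
Star k = record { n = k ; adj = starAdj ; adj-sym = starAdj-sym ; adj-irr = starAdj-irr }

data NamedH : Set where
  c3 twoK2 p4 c4 c3+e k4-e p2∪p3 s12 p5 c3+e+e c3+2e c4+e s22 : NamedH

graphOf : NamedH → Graph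
graphOf c3     = C3
graphOf twoK2  = TwoK2
graphOf p4     = P4
graphOf c4     = C4
graphOf c3+e   = C3+e
graphOf k4-e   = K4-e
graphOf p2∪p3  = P2∪P3
graphOf s12    = S12
graphOf p5     = P5
graphOf c3+e+e = C3+e+e
graphOf c3+2e  = C3+2e
graphOf c4+e   = C4+e
graphOf s22    = S22

{-# OPTIONS --safe #-}
module Submission where

-- Each graph is realised by an explicit small subcubic graph with a partition, certified by a
-- decision procedure for connected domination. Infinitely many pairwise non-isomorphic
-- realisations come from enlarging the graph without changing which unions of classes are
-- connected dominating sets: at a rung, an edge p q between classes P and Q with N(p) ⊆ P ∪ Q
-- and further neighbours p′ ∈ P of p and q′ ∈ Q of q, the edges p p′ and q q′ are subdivided
-- and the two new vertices are joined, which creates a new rung. For the stars the centre class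
-- has two connected halves which every leaf class joins; a new leaf class is a single vertex
-- bridging new vertices that subdivide an edge in each half.

open import Defs
open import Data.Bool using (Bool; true; false; not; _∧_; _∨_; if_then_else_)
import Data.Bool.Properties as Bool
open import Data.Empty using (⊥; ⊥-elim)
open import Data.Fin using (Fin; zero; suc; _≟_; #_; fromℕ; inject₁)
open import Data.Fin.Permutation using (↔⇒≡)
open import Data.Fin.Properties
  using (all?; any?; fromℕ≢inject₁; inject₁-injective; suc-injective)
open import Data.Fin.Relation.Unary.Top using (view; ‵fromℕ; ‵inject₁)
open import Data.Fin.Subset using (Subset; _∈_; _⊆_; ⁅_⁆; ∣_∣)
open import Data.Fin.Subset.Properties
  using (_∈?_; x∈⁅x⁆; x∈⁅y⁆⇒x≡y; ∣⁅x⁆∣≡1; ∣p∣≤n; p⊂q⇒∣p∣<∣q∣)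
open import Data.List using ([]; _∷_; length; filterᵇ)
import Data.List as List
open import Data.Nat using (ℕ; zero; suc; _+_; _*_; _<_; _≤_; _≤?_; z≤n; s≤s)
open import Data.Nat.Properties
  using (≤-trans; ≤-reflexive; <-≤-trans; <-irrefl; m≤n⇒m≤1+n; +-suc; +-cancelʳ-≡; *-cancelʳ-≡)
open import Data.Product using (Σ; ∃; _×_; _,_; proj₁; proj₂)
open import Data.Sum using (_⊎_; inj₁; inj₂; [_,_]; swap)
open import Data.Unit using (⊤; tt)
open import Data.Vec using ([]; _∷_; lookup; tabulate)
open import Data.Vec.Properties using (lookup∘tabulate; lookup⇒[]=; []=⇒lookup)
open import Function using (_∘_; id)
open import Function.Bundles using (_⇔_; mk⇔; Equivalence)
open Equivalence using (to; from)
open import Function.Construct.Composition using (_⇔-∘_)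
open import Function.Construct.Identity using (↔-id)
open import Function.Construct.Symmetry using (⇔-sym)
open import Relation.Binary.PropositionalEquality
  using (_≡_; _≢_; refl; sym; trans; cong; cong₂; subst)
open import Relation.Nullary using (Dec; yes; no; does; ¬_; ¬?)
open import Relation.Nullary.Decidable
  using (_×-dec_; _⊎-dec_; _→-dec_; map′; decidable-stable; dec-true; dec-false; does-⇔;
         True; toWitness; from-yes)
open import Relation.Unary using (Decidable)

from-does : ∀ {A : Set} (a? : Dec A) → does a? ≡ true → A
from-does (yes a) _ = a

Adj-sym : (G : Graph) {u v : V G} → Adj G u v → Adj G v u
Adj-sym G {u} {v} uv = trans (adj-sym G v u) uv

Adj? : (G : Graph) (u v : V G) → Dec (Adj G u v)
Adj? G u v = adj G u v Bool.≟ true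

module _ {G : Graph} {S : VSet G} where

  walk-start : ∀ {u v} → WalkIn G S u v → S u
  walk-start (here su) = su
  walk-start (step su _ _) = su

  walk-snoc : ∀ {u v w} → WalkIn G S u v → Adj G v w → S w → WalkIn G S u w
  walk-snoc (here sv) vw sw = step sv vw (here sw)
  walk-snoc (step su uu′ p) vw sw = step su uu′ (walk-snoc p vw sw)

  walk-++ : ∀ {u v w} → WalkIn G S u v → WalkIn G S v w → WalkIn G S u w
  walk-++ (here _) q = q
  walk-++ (step su uu′ p) q = step su uu′ (walk-++ p q)

  walk-reverse : ∀ {u v} → WalkIn G S u v → WalkIn G S v u
  walk-reverse (here su) = here su
  walk-reverse (step su uu′ p) = walk-snoc (walk-reverse p) (Adj-sym G uu′) su

walk-mono : ∀ {G : Graph} {S T : VSet G} → (∀ {v} → S v → T v) →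
            ∀ {u v} → WalkIn G S u v → WalkIn G T u v
walk-mono S⊆T (here su) = here (S⊆T su)
walk-mono S⊆T (step su uu′ p) = step (S⊆T su) uu′ (walk-mono S⊆T p)

walk-map : ∀ {G H : Graph} {S : VSet G} {T : VSet H} (f : V G → V H) →
           (∀ {v} → S v → T (f v)) →
           (∀ {u v} → Adj G u v → f u ≡ f v ⊎ Adj H (f u) (f v)) →
           ∀ {u v} → WalkIn G S u v → WalkIn H T (f u) (f v)
walk-map f S→T edge (here su) = here (S→T su)
walk-map {H = H} {T = T} f S→T edge {v = v} (step su uu′ p) with edge uu′
... | inj₁ fu≡fu′ = subst (λ x → WalkIn H T x (f v)) (sym fu≡fu′) (walk-map f S→T edge p)
... | inj₂ fuu′ = step (S→T su) fuu′ (walk-map f S→T edge p)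

connected-via-hub : (G : Graph) {S : VSet G} (h : V G) → (∀ {v} → S v → WalkIn G S v h) →
  InducedConnected G S
connected-via-hub G h ↝h u v su sv = walk-++ (↝h su) (walk-reverse (↝h sv))

dominating-mono : (G : Graph) {S T : VSet G} → (∀ {v} → S v → T v) → Dominating G S → Dominating G T
dominating-mono G S⊆T dom v ¬tv =
  let (u , su , uv) = dom v (¬tv ∘ S⊆T) in u , S⊆T su , uv

connectedDominating-resp : (G : Graph) {S T : VSet G} →
  (∀ {v} → S v → T v) → (∀ {v} → T v → S v) →
  ConnectedDominating G S → ConnectedDominating G T
connectedDominating-resp G S⊆T T⊆S (dom , con) =
  dominating-mono G S⊆T dom , λ u v tu tv → walk-mono S⊆T (con u v (T⊆S tu) (T⊆S tv))

connectedDominating⇒connected : (G : Graph) {S : VSet G} → Decidable S →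
  ConnectedDominating G S → Connected G
connectedDominating⇒connected G {S} S? (dom , con) u v _ _ =
  let (u′ , su′ , u′u) = near u ; (v′ , sv′ , v′v) = near v
  in walk-++ (walk-reverse u′u) (walk-++ (walk-mono (λ _ → tt) (con u′ v′ su′ sv′)) v′v)
  where
  near : ∀ w → ∃ λ w′ → S w′ × WalkIn G (λ _ → ⊤) w′ w
  near w with S? w
  ... | yes sw = w , sw , here tt
  ... | no ¬sw = let (w′ , sw′ , w′w) = dom w ¬sw in w′ , sw′ , step tt w′w (here tt)

-- Deciding connected domination

module Reachability (G : Graph) {S : VSet G} (S? : Decidable S) where

  Expansion : Subset (n G) → V G → Set
  Expansion R v = v ∈ R ⊎ (S v × ∃ λ u → u ∈ R × Adj G u v)

  expansion? : (R : Subset (n G)) → Decidable (Expansion R)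
  expansion? R v = v ∈? R ⊎-dec (S? v ×-dec any? λ u → u ∈? R ×-dec Adj? G u v)

  expand : Subset (n G) → Subset (n G)
  expand R = tabulate (does ∘ expansion? R)

  ∈-expand⁻ : ∀ {R v} → v ∈ expand R → Expansion R v
  ∈-expand⁻ {R} {v} v∈ =
    from-does (expansion? R v) (trans (sym (lookup∘tabulate _ v)) ([]=⇒lookup v∈))

  ∈-expand⁺ : ∀ {R v} → Expansion R v → v ∈ expand R
  ∈-expand⁺ {R} {v} e =
    lookup⇒[]= v _ (trans (lookup∘tabulate _ v) (dec-true (expansion? R v) e))

  expand-mono : ∀ {R R′} → R ⊆ R′ → expand R ⊆ expand R′
  expand-mono R⊆R′ v∈ with ∈-expand⁻ v∈
  ... | inj₁ v∈R = ∈-expand⁺ (inj₁ (R⊆R′ v∈R))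
  ... | inj₂ (sv , u , u∈R , uv) = ∈-expand⁺ (inj₂ (sv , u , R⊆R′ u∈R , uv))

  expand-extensive : ∀ {R} → R ⊆ expand R
  expand-extensive v∈R = ∈-expand⁺ (inj₁ v∈R)

  reach : V G → ℕ → Subset (n G)
  reach r zero = ⁅ r ⁆
  reach r (suc t) = expand (reach r t)

  reach-walk : ∀ {r} → S r → ∀ t {v} → v ∈ reach r t → WalkIn G S r v
  reach-walk sr zero v∈ rewrite x∈⁅y⁆⇒x≡y _ v∈ = here sr
  reach-walk sr (suc t) v∈ with ∈-expand⁻ v∈
  ... | inj₁ v∈R = reach-walk sr t v∈R
  ... | inj₂ (sv , u , u∈R , uv) = walk-snoc (reach-walk sr t u∈R) uv sv

  reach-root : ∀ r t → r ∈ reach r t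
  reach-root r zero = x∈⁅x⁆ r
  reach-root r (suc t) = expand-extensive (reach-root r t)

  Closed : Subset (n G) → Set
  Closed R = expand R ⊆ R

  closed-walk : ∀ {R} → Closed R → ∀ {u v} → WalkIn G S u v → u ∈ R → v ∈ R
  closed-walk closed (here _) u∈R = u∈R
  closed-walk closed (step _ uw p) u∈R =
    closed-walk closed p (closed (∈-expand⁺ (inj₂ (walk-start p , _ , u∈R , uw))))

  closed-or-grows : ∀ R → Closed R ⊎ ∣ R ∣ < ∣ expand R ∣
  closed-or-grows R with any? (λ v → v ∈? expand R ×-dec ¬? (v ∈? R))
  ... | yes (v , v∈ , v∉) = inj₂ (p⊂q⇒∣p∣<∣q∣ (expand-extensive , v , v∈ , v∉))
  ... | no ∄ = inj₁ λ {v} v∈ → decidable-stable (v ∈? R) (λ v∉ → ∄ (v , v∈ , v∉))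

  -- Until it is closed, the reach set gains a vertex in every round, so after n G rounds
  -- it is the whole component of r in G[S].
  reach-closed-or-large : ∀ r t → Closed (reach r t) ⊎ t < ∣ reach r t ∣
  reach-closed-or-large r zero = inj₂ (subst (0 <_) (sym (∣⁅x⁆∣≡1 r)) (s≤s z≤n))
  reach-closed-or-large r (suc t) with closed-or-grows (reach r t)
  ... | inj₁ closed = inj₁ (expand-mono closed)
  ... | inj₂ grows with reach-closed-or-large r t
  ...   | inj₁ closed = inj₁ (expand-mono closed)
  ...   | inj₂ large = inj₂ (<-≤-trans (s≤s large) grows)

  reach-closed : ∀ r → Closed (reach r (n G))
  reach-closed r with reach-closed-or-large r (n G)
  ... | inj₁ closed = closed
  ... | inj₂ large = ⊥-elim (<-irrefl refl (<-≤-trans large (∣p∣≤n (reach r (n G)))))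

connected? : (G : Graph) {S : VSet G} → Decidable S → Dec (InducedConnected G S)
connected? G {S} S? with any? S?
... | no ∄ = yes λ u _ su _ → ⊥-elim (∄ (u , su))
... | yes (r , sr) =
  map′ (λ r↝ → connected-via-hub G r (walk-reverse ∘ walk-to r↝))
       (λ con v sv → closed-walk (reach-closed r) (con r v sr sv) (reach-root r (n G)))
       (all? λ v → S? v →-dec v ∈? reach r (n G))
  where
  open Reachability G S?
  walk-to : (∀ v → S v → v ∈ reach r (n G)) → ∀ {v} → S v → WalkIn G S r v
  walk-to r↝ {v} sv = reach-walk sr (n G) (r↝ v sv)

dominating? : (G : Graph) {S : VSet G} → Decidable S → Dec (Dominating G S)
dominating? G S? = all? λ v → ¬? (S? v) →-dec any? λ u → S? u ×-dec Adj? G u v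

connectedDominating? : (G : Graph) {S : VSet G} → Decidable S → Dec (ConnectedDominating G S)
connectedDominating? G S? = dominating? G S? ×-dec connected? G S?

disjoint? : (G : Graph) {A B : VSet G} → Decidable A → Decidable B → Dec (Disjoint {G} A B)
disjoint? G A? B? = map′ (λ ∄ v av bv → ∄ v (av , bv)) (λ disj v (av , bv) → disj v av bv)
                         (all? λ v → ¬? (A? v ×-dec B? v))

connCoalition? : (G : Graph) {A B : VSet G} → Decidable A → Decidable B → Dec (ConnCoalition G A B)
connCoalition? G A? B? =
  disjoint? G A? B? ×-dec ¬? (connectedDominating? G A?) ×-dec ¬? (connectedDominating? G B?)
  ×-dec connectedDominating? G (λ v → A? v ⊎-dec B? v)

record IsRealisation (H G : Graph) (π : V G → V H) : Set where
  field
    partition : IsPartition G π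
    deg≤3 : ∀ v → deg G v ≤ 3
    connected : Connected G
    coalition⇔adj : ∀ i j → ConnCoalition G (Class G π i) (Class G π j) ⇔ Adj H i j

record Realisation (H : Graph) : Set where
  field
    G : Graph
    π : V G → V H
    isRealisation : IsRealisation H G π
  open IsRealisation isRealisation public

isRealisation? : (H G : Graph) (π : V G → V H) → Dec (IsRealisation H G π)
isRealisation? H G π =
  map′ (λ (s , d , c , e) → record { partition = s ; deg≤3 = d ; connected = c ; coalition⇔adj = e })
       (λ r → let open IsRealisation r in partition , deg≤3 , connected , coalition⇔adj)
       ((all? λ i → any? λ v → π v ≟ i) ×-dec (all? λ v → deg G v ≤? 3) ×-dec
        connected? G (λ _ → yes tt) ×-dec (all? λ i → all? λ j → coalition⇔adj? i j))
  where
  coalition⇔adj? : ∀ i j → Dec (ConnCoalition G (Class G π i) (Class G π j) ⇔ Adj H i j)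
  coalition⇔adj? i j =
    map′ (λ (coal⇒adj , adj⇒coal) → mk⇔ coal⇒adj adj⇒coal) (λ e → to e , from e)
         ((coal? →-dec Adj? H i j) ×-dec (Adj? H i j →-dec coal?))
    where
    coal? : Dec (ConnCoalition G (Class G π i) (Class G π j))
    coal? = connCoalition? G (λ v → π v ≟ i) (λ v → π v ≟ j)

NoIsolatedVertex : Graph → Set
NoIsolatedVertex H = ∀ i → ∃ λ j → Adj H i j

noIsolatedVertex? : (H : Graph) → Dec (NoIsolatedVertex H)
noIsolatedVertex? H = all? λ i → any? λ j → Adj? H i j

realisation⇒ccp : ∀ {H} → V H → NoIsolatedVertex H → (R : Realisation H) →
  let open Realisation R in Subcubic G × HasCCPWithCCG G H
realisation⇒ccp {H} i₀ noIsolated R =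
  (nonempty (proj₁ (partition i₀)) , connected , deg≤3) ,
  n H , π , (partition , coalition) , ↔-id _ , coalition⇔adj
  where
  open Realisation R
  nonempty : ∀ {m} → Fin m → 1 ≤ m
  nonempty zero = s≤s z≤n
  nonempty (suc _) = s≤s z≤n
  coalition : ∀ i → (IsSingleton {G} (Class G π i) × ConnectedDominating G (Class G π i))
                      ⊎ (∃ λ j → ConnCoalition G (Class G π i) (Class G π j))
  coalition i = let (j , ij) = noIsolated i in inj₂ (j , from (coalition⇔adj i j) ij)

classes-disjoint⇔ : ∀ {k} (G : Graph) {π : V G → Fin k} → IsPartition G π → ∀ i j →
  Disjoint {G} (Class G π i) (Class G π j) ⇔ i ≢ j
classes-disjoint⇔ G part i j = mk⇔
  (λ disj i≡j → let (v , πv≡i) = part i in disj v πv≡i (trans πv≡i i≡j))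
  (λ i≢j v πv≡i πv≡j → i≢j (trans (sym πv≡i) πv≡j))

coalitions-transfer : ∀ {k} {G G′ : Graph} {π : V G → Fin k} {π′ : V G′ → Fin k} →
  IsPartition G π → IsPartition G′ π′ →
  (∀ {T : Fin k → Set} → Decidable T →
     ConnectedDominating G (T ∘ π) ⇔ ConnectedDominating G′ (T ∘ π′)) →
  ∀ i j → ConnCoalition G (Class G π i) (Class G π j) ⇔ ConnCoalition G′ (Class G′ π′ i) (Class G′ π′ j)
coalitions-transfer {G = G} {G′} {π} {π′} part part′ cds⇔ i j = mk⇔
  (λ (disj , ¬ci , ¬cj , cij) →
     from (classes-disjoint⇔ G′ part′ i j) (to (classes-disjoint⇔ G part i j) disj) ,
     ¬ci ∘ from cds-i , ¬cj ∘ from cds-j , to cds-ij cij)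
  (λ (disj , ¬ci , ¬cj , cij) →
     from (classes-disjoint⇔ G part i j) (to (classes-disjoint⇔ G′ part′ i j) disj) ,
     ¬ci ∘ to cds-i , ¬cj ∘ to cds-j , from cds-ij cij)
  where
  cds-i : ConnectedDominating G (Class G π i) ⇔ ConnectedDominating G′ (Class G′ π′ i)
  cds-i = cds⇔ (_≟ i)
  cds-j : ConnectedDominating G (Class G π j) ⇔ ConnectedDominating G′ (Class G′ π′ j)
  cds-j = cds⇔ (_≟ j)
  cds-ij : ConnectedDominating G (_∪ˢ_ {G} (Class G π i) (Class G π j))
         ⇔ ConnectedDominating G′ (_∪ˢ_ {G′} (Class G′ π′ i) (Class G′ π′ j))
  cds-ij = cds⇔ (λ c → c ≟ i ⊎-dec c ≟ j)

count : ∀ {m} → (Fin m → Bool) → ℕ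
count {zero} f = 0
count {suc m} f = (if f zero then 1 else 0) + count (f ∘ suc)

length-filterᵇ-tabulate : ∀ {A : Set} {m} (f : A → Bool) (g : Fin m → A) →
  length (filterᵇ f (List.tabulate g)) ≡ count (f ∘ g)
length-filterᵇ-tabulate {m = zero} f g = refl
length-filterᵇ-tabulate {m = suc m} f g with f (g zero)
... | true = cong suc (length-filterᵇ-tabulate f (g ∘ suc))
... | false = length-filterᵇ-tabulate f (g ∘ suc)

deg≡count : (G : Graph) (v : V G) → deg G v ≡ count (adj G v)
deg≡count G v = length-filterᵇ-tabulate (adj G v) id

count-mono : ∀ {m} {f g : Fin m → Bool} → (∀ u → f u ≡ true → g u ≡ true) → count f ≤ count g
count-mono {zero} f⊆g = z≤n
count-mono {suc m} {f} {g} f⊆g with f zero in f0 | g zero in g0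
... | true | true = s≤s (count-mono (f⊆g ∘ suc))
... | false | true = m≤n⇒m≤1+n (count-mono (f⊆g ∘ suc))
... | false | false = count-mono (f⊆g ∘ suc)
... | true | false with () ← trans (sym (f⊆g zero f0)) g0

count-strict : ∀ {m} {f g : Fin m → Bool} → (∀ u → f u ≡ true → g u ≡ true) →
  ∀ w → g w ≡ true → f w ≡ false → suc (count f) ≤ count g
count-strict {suc m} {f} {g} f⊆g zero gw fw rewrite gw | fw = s≤s (count-mono (f⊆g ∘ suc))
count-strict {suc m} {f} {g} f⊆g (suc w) gw fw with f zero in f0 | g zero in g0
... | true | true = s≤s (count-strict (f⊆g ∘ suc) w gw fw)
... | false | true = m≤n⇒m≤1+n (count-strict (f⊆g ∘ suc) w gw fw)
... | false | false = count-strict (f⊆g ∘ suc) w gw fw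
... | true | false with () ← trans (sym (f⊆g zero f0)) g0

count-∨ : ∀ {m} (f g : Fin m → Bool) → count (λ u → f u ∨ g u) ≤ count f + count g
count-∨ {zero} f g = z≤n
count-∨ {suc m} f g with f zero | g zero
... | true | true = s≤s (≤-trans (m≤n⇒m≤1+n (count-∨ (f ∘ suc) (g ∘ suc)))
                               (≤-reflexive (sym (+-suc (count (f ∘ suc)) (count (g ∘ suc))))))
... | true | false = s≤s (count-∨ (f ∘ suc) (g ∘ suc))
... | false | true = ≤-trans (s≤s (count-∨ (f ∘ suc) (g ∘ suc)))
                            (≤-reflexive (sym (+-suc (count (f ∘ suc)) (count (g ∘ suc)))))
... | false | false = count-∨ (f ∘ suc) (g ∘ suc)

count-false : ∀ m → count {m} (λ _ → false) ≡ 0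
count-false zero = refl
count-false (suc m) = count-false m

count-≟ : ∀ {m} (a : Fin m) → count (λ u → does (u ≟ a)) ≡ 1
count-≟ {suc m} zero = cong suc (count-false m)
count-≟ {suc m} (suc a) = count-≟ a

count-pair : ∀ {m} (a b : Fin m) → count (λ u → does (u ≟ a ⊎-dec u ≟ b)) ≤ 2
count-pair a b = ≤-trans (count-∨ (λ u → does (u ≟ a)) (λ u → does (u ≟ b)))
                         (≤-reflexive (cong₂ _+_ (count-≟ a) (count-≟ b)))

-- Ladders

record IsRung {k : ℕ} (G : Graph) (π : V G → Fin k) (p p′ q q′ : V G) : Set where
  field
    p∼p′ : Adj G p p′
    q∼q′ : Adj G q q′
    p∼q : Adj G p q
    πp′≡πp : π p′ ≡ π p
    πq′≡πq : π q′ ≡ π q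
    πp≢πq : π p ≢ π q
    N[p]⊆P∪Q : ∀ u → Adj G p u → π u ≡ π p ⊎ π u ≡ π q

isRung? : ∀ {k} (G : Graph) (π : V G → Fin k) (p p′ q q′ : V G) → Dec (IsRung G π p p′ q q′)
isRung? G π p p′ q q′ =
  map′ (λ (pp′ , qq′ , pq , πp′ , πq′ , πp≢πq , N[p]) → record
         { p∼p′ = pp′ ; q∼q′ = qq′ ; p∼q = pq ; πp′≡πp = πp′ ; πq′≡πq = πq′ ; πp≢πq = πp≢πq
         ; N[p]⊆P∪Q = N[p] })
       (λ r → let open IsRung r in p∼p′ , q∼q′ , p∼q , πp′≡πp , πq′≡πq , πp≢πq , N[p]⊆P∪Q)
       (Adj? G p p′ ×-dec Adj? G q q′ ×-dec Adj? G p q ×-dec π p′ ≟ π p ×-dec π q′ ≟ π q ×-dec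
        ¬? (π p ≟ π q) ×-dec all? λ u → Adj? G p u →-dec (π u ≟ π p ⊎-dec π u ≟ π q))

record Rung {k : ℕ} (G : Graph) (π : V G → Fin k) : Set where
  field
    p p′ q q′ : V G
    isRung : IsRung G π p p′ q q′
  open IsRung isRung public

module TwoEdgeCut (G : Graph) (p p′ q q′ : V G) where

  InP InQ Endpoint : V G → Set
  InP v = v ≡ p ⊎ v ≡ p′
  InQ v = v ≡ q ⊎ v ≡ q′
  Endpoint v = InP v ⊎ InQ v

  inP? : Decidable InP
  inP? v = v ≟ p ⊎-dec v ≟ p′

  inQ? : Decidable InQ
  inQ? v = v ≟ q ⊎-dec v ≟ q′

  endpoint? : Decidable Endpoint
  endpoint? v = inP? v ⊎-dec inQ? v

  Cut : V G → V G → Set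
  Cut u v = (InP u × InP v) ⊎ (InQ u × InQ v)

  Cut⇒Endpoint : ∀ {u v} → Cut u v → Endpoint u
  Cut⇒Endpoint (inj₁ (u∈P , _)) = inj₁ u∈P
  Cut⇒Endpoint (inj₂ (u∈Q , _)) = inj₂ u∈Q

  cut? : ∀ u v → Dec (Cut u v)
  cut? u v = (inP? u ×-dec inP? v) ⊎-dec (inQ? u ×-dec inQ? v)

  Cut-sym : ∀ {u v} → Cut u v → Cut v u
  Cut-sym (inj₁ (u∈P , v∈P)) = inj₁ (v∈P , u∈P)
  Cut-sym (inj₂ (u∈Q , v∈Q)) = inj₂ (v∈Q , u∈Q)

  adjᶜ : V G → V G → Bool
  adjᶜ u v = adj G u v ∧ not (does (cut? u v))

  adjᶜ-sym : ∀ u v → adjᶜ u v ≡ adjᶜ v u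
  adjᶜ-sym u v =
    cong₂ (λ a c → a ∧ not c) (adj-sym G u v) (does-⇔ (mk⇔ Cut-sym Cut-sym) (cut? u v) (cut? v u))

  adjᶜ-irr : ∀ v → adjᶜ v v ≡ false
  adjᶜ-irr v rewrite adj-irr G v = refl

  adjᶜ⇒adj : ∀ u v → adjᶜ u v ≡ true → Adj G u v
  adjᶜ⇒adj u v = Bool.∧-conicalˡ _ _

  adj⇒adjᶜ : ∀ {u v} → Adj G u v → ¬ Cut u v → adjᶜ u v ≡ true
  adj⇒adjᶜ {u} {v} uv ¬cut rewrite uv | dec-false (cut? u v) ¬cut = refl

  module Degrees (p∼p′ : Adj G p p′) (q∼q′ : Adj G q q′) (P∩Q≡∅ : ∀ {v} → InP v → InQ v → ⊥) where

    cut-neighbour : ∀ {v} → Endpoint v → ∃ λ w → Adj G v w × Cut v w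
    cut-neighbour (inj₁ (inj₁ refl)) = p′ , p∼p′ , inj₁ (inj₁ refl , inj₂ refl)
    cut-neighbour (inj₁ (inj₂ refl)) = p , Adj-sym G p∼p′ , inj₁ (inj₂ refl , inj₁ refl)
    cut-neighbour (inj₂ (inj₁ refl)) = q′ , q∼q′ , inj₂ (inj₁ refl , inj₂ refl)
    cut-neighbour (inj₂ (inj₂ refl)) = q , Adj-sym G q∼q′ , inj₂ (inj₂ refl , inj₁ refl)

    adjᶜ-strict : ∀ {v} → Endpoint v → suc (count (adjᶜ v)) ≤ count (adj G v)
    adjᶜ-strict {v} v∈P∪Q with cut-neighbour v∈P∪Q
    ... | w , vw , cut = count-strict (adjᶜ⇒adj v) w vw vw-removed
      where
      vw-removed : adjᶜ v w ≡ false
      vw-removed rewrite vw | dec-true (cut? v w) cut = refl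

    -- An endpoint of a cut edge may receive one new neighbour in exchange.
    count-adjᶜ : ∀ v →
      (if does (inP? v) then 1 else 0) + ((if does (inQ? v) then 1 else 0) + count (adjᶜ v))
      ≤ count (adj G v)
    count-adjᶜ v = bound (inP? v) (inQ? v)
      where
      bound : (v∈P? : Dec (InP v)) (v∈Q? : Dec (InQ v)) →
        (if does v∈P? then 1 else 0) + ((if does v∈Q? then 1 else 0) + count (adjᶜ v))
        ≤ count (adj G v)
      bound (yes v∈P) (yes v∈Q) = ⊥-elim (P∩Q≡∅ v∈P v∈Q)
      bound (yes v∈P) (no _) = adjᶜ-strict (inj₁ v∈P)
      bound (no _) (yes v∈Q) = adjᶜ-strict (inj₂ v∈Q)
      bound (no _) (no _) = count-mono (adjᶜ⇒adj v)

  module Lifting (G′ : Graph) (old : V G → V G′) (x y : V G′)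
                 (x∼old : ∀ {v} → InP v → Adj G′ x (old v))
                 (y∼old : ∀ {v} → InQ v → Adj G′ y (old v))
                 (old∼old : ∀ {u v} → adjᶜ u v ≡ true → Adj G′ (old u) (old v)) where

    -- A cut edge u w inside {p, p′} is replaced by the path u x w, and similarly for q.
    lift-walk : ∀ {S : VSet G} {S′ : VSet G′} → (∀ {v} → S v → S′ (old v)) →
      (∀ {v} → S v → InP v → S′ x) → (∀ {v} → S v → InQ v → S′ y) →
      ∀ {u v} → WalkIn G S u v → WalkIn G′ S′ (old u) (old v)
    lift-walk S⇒S′ S⇒x S⇒y (here su) = here (S⇒S′ su)
    lift-walk S⇒S′ S⇒x S⇒y {u} (step {w = w} su uw walk) with cut? u w
    ... | no ¬cut = step (S⇒S′ su) (old∼old (adj⇒adjᶜ uw ¬cut)) (lift-walk S⇒S′ S⇒x S⇒y walk)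
    ... | yes (inj₁ (u∈P , w∈P)) =
      step {w = x} (S⇒S′ su) (Adj-sym G′ {x} {old u} (x∼old u∈P))
        (step (S⇒x su u∈P) (x∼old w∈P) (lift-walk S⇒S′ S⇒x S⇒y walk))
    ... | yes (inj₂ (u∈Q , w∈Q)) =
      step {w = y} (S⇒S′ su) (Adj-sym G′ {y} {old u} (y∼old u∈Q))
        (step (S⇒y su u∈Q) (y∼old w∈Q) (lift-walk S⇒S′ S⇒x S⇒y walk))

-- The edges p p′ and q q′ are subdivided by new vertices x⁺ ∈ P and y⁺ ∈ Q joined by
-- an edge; x⁺ y⁺ is then a rung of the same kind one step further along the ladder.
module Ladder {k : ℕ} (G : Graph) (π : V G → Fin k) (rung : Rung G π) where
  open Rung rung
  open TwoEdgeCut G p p′ q q′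

  pattern x⁺ = zero
  pattern y⁺ = suc zero
  pattern old v = suc (suc v)

  adj⁺ : Fin (2 + n G) → Fin (2 + n G) → Bool
  adj⁺ x⁺ x⁺ = false
  adj⁺ x⁺ y⁺ = true
  adj⁺ x⁺ (old v) = does (inP? v)
  adj⁺ y⁺ x⁺ = true
  adj⁺ y⁺ y⁺ = false
  adj⁺ y⁺ (old v) = does (inQ? v)
  adj⁺ (old u) x⁺ = does (inP? u)
  adj⁺ (old u) y⁺ = does (inQ? u)
  adj⁺ (old u) (old v) = adjᶜ u v

  adj⁺-sym : ∀ u v → adj⁺ u v ≡ adj⁺ v u
  adj⁺-sym x⁺ x⁺ = refl
  adj⁺-sym x⁺ y⁺ = refl
  adj⁺-sym x⁺ (old v) = refl
  adj⁺-sym y⁺ x⁺ = refl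
  adj⁺-sym y⁺ y⁺ = refl
  adj⁺-sym y⁺ (old v) = refl
  adj⁺-sym (old u) x⁺ = refl
  adj⁺-sym (old u) y⁺ = refl
  adj⁺-sym (old u) (old v) = adjᶜ-sym u v

  adj⁺-irr : ∀ v → adj⁺ v v ≡ false
  adj⁺-irr x⁺ = refl
  adj⁺-irr y⁺ = refl
  adj⁺-irr (old v) = adjᶜ-irr v

  G⁺ : Graph
  G⁺ = record { n = 2 + n G ; adj = adj⁺ ; adj-sym = adj⁺-sym ; adj-irr = adj⁺-irr }

  π⁺ : V G⁺ → Fin k
  π⁺ x⁺ = π p
  π⁺ y⁺ = π q
  π⁺ (old v) = π v

  InP⇒πp : ∀ {v} → InP v → π v ≡ π p
  InP⇒πp (inj₁ refl) = refl
  InP⇒πp (inj₂ refl) = πp′≡πp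

  InQ⇒πq : ∀ {v} → InQ v → π v ≡ π q
  InQ⇒πq (inj₁ refl) = refl
  InQ⇒πq (inj₂ refl) = πq′≡πq

  Cut⇒same-class : ∀ {u v} → Cut u v → π u ≡ π v
  Cut⇒same-class (inj₁ (u∈P , v∈P)) = trans (InP⇒πp u∈P) (sym (InP⇒πp v∈P))
  Cut⇒same-class (inj₂ (u∈Q , v∈Q)) = trans (InQ⇒πq u∈Q) (sym (InQ⇒πq v∈Q))

  x⁺∼old : ∀ {v} → InP v → Adj G⁺ x⁺ (old v)
  x⁺∼old {v} v∈P = dec-true (inP? v) v∈P

  y⁺∼old : ∀ {v} → InQ v → Adj G⁺ y⁺ (old v)
  y⁺∼old {v} v∈Q = dec-true (inQ? v) v∈Q

  open Degrees p∼p′ q∼q′ (λ v∈P v∈Q → πp≢πq (trans (sym (InP⇒πp v∈P)) (InQ⇒πq v∈Q)))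
  open Lifting G⁺ (λ v → old v) x⁺ y⁺ x⁺∼old y⁺∼old id

  deg⁺≤3 : (∀ v → deg G v ≤ 3) → ∀ v → deg G⁺ v ≤ 3
  deg⁺≤3 deg≤3 v rewrite deg≡count G⁺ v = row≤3 v
    where
    row≤3 : ∀ v → count (adj⁺ v) ≤ 3
    row≤3 x⁺ = s≤s (count-pair p p′)
    row≤3 y⁺ = s≤s (count-pair q q′)
    row≤3 (old v) = ≤-trans (count-adjᶜ v) (subst (_≤ 3) (deg≡count G v) (deg≤3 v))

  collapse : V G⁺ → V G
  collapse x⁺ = p
  collapse y⁺ = q
  collapse (old v) = v

  π⁺≡π∘collapse : ∀ w → π⁺ w ≡ π (collapse w)
  π⁺≡π∘collapse x⁺ = refl
  π⁺≡π∘collapse y⁺ = refl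
  π⁺≡π∘collapse (old v) = refl

  collapse-adj : ∀ u v → Adj G⁺ u v → collapse u ≡ collapse v ⊎ Adj G (collapse u) (collapse v)
  collapse-adj x⁺ y⁺ _ = inj₂ p∼q
  collapse-adj y⁺ x⁺ _ = inj₂ (Adj-sym G p∼q)
  collapse-adj x⁺ (old v) e with from-does (inP? v) e
  ... | inj₁ refl = inj₁ refl
  ... | inj₂ refl = inj₂ p∼p′
  collapse-adj y⁺ (old v) e with from-does (inQ? v) e
  ... | inj₁ refl = inj₁ refl
  ... | inj₂ refl = inj₂ q∼q′
  collapse-adj (old u) x⁺ e with from-does (inP? u) e
  ... | inj₁ refl = inj₁ refl
  ... | inj₂ refl = inj₂ (Adj-sym G p∼p′)
  collapse-adj (old u) y⁺ e with from-does (inQ? u) e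
  ... | inj₁ refl = inj₁ refl
  ... | inj₂ refl = inj₂ (Adj-sym G q∼q′)
  collapse-adj (old u) (old v) e = inj₂ (adjᶜ⇒adj u v e)

  module _ {T : Fin k → Set} where

    walk-to-old : ∀ {w} → T (π⁺ w) → ∃ λ v → T (π v) × WalkIn G⁺ (T ∘ π⁺) w (old v)
    walk-to-old {x⁺} tx = p , tx , step {w = old p} tx (x⁺∼old (inj₁ refl)) (here tx)
    walk-to-old {y⁺} ty = q , ty , step {w = old q} ty (y⁺∼old (inj₁ refl)) (here ty)
    walk-to-old {old v} tv = v , tv , here tv

    connected⁺ : InducedConnected G (T ∘ π) → InducedConnected G⁺ (T ∘ π⁺)
    connected⁺ con u v tu tv with walk-to-old tu | walk-to-old tv
    ... | u′ , tu′ , uu′ | v′ , tv′ , vv′ =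
      walk-++ uu′ (walk-++ (lift-walk id (λ tu u∈P → subst T (InP⇒πp u∈P) tu)
                                        (λ tu u∈Q → subst T (InQ⇒πq u∈Q) tu) (con u′ v′ tu′ tv′))
                           (walk-reverse vv′))

    connected⁻ : InducedConnected G⁺ (T ∘ π⁺) → InducedConnected G (T ∘ π)
    connected⁻ con u v tu tv =
      walk-map collapse (λ {w} → subst T (π⁺≡π∘collapse w)) (λ {u} {v} → collapse-adj u v)
               (con (old u) (old v) tu tv)

    -- A dominating union of classes contains P or Q, since the neighbours of p lie in P ∪ Q.
    dominating⁺ : Decidable T → Dominating G (T ∘ π) → Dominating G⁺ (T ∘ π⁺)
    dominating⁺ T? dom x⁺ ¬tx with dom p ¬tx
    ... | u , tu , up with N[p]⊆P∪Q u (Adj-sym G up)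
    ...   | inj₁ πu≡πp = ⊥-elim (¬tx (subst T πu≡πp tu))
    ...   | inj₂ πu≡πq = y⁺ , subst T πu≡πq tu , refl
    dominating⁺ T? dom y⁺ ¬ty with T? (π p)
    ... | yes tx = x⁺ , tx , refl
    ... | no ¬tx with dom p ¬tx
    ...   | u , tu , up with N[p]⊆P∪Q u (Adj-sym G up)
    ...     | inj₁ πu≡πp = ⊥-elim (¬tx (subst T πu≡πp tu))
    ...     | inj₂ πu≡πq = ⊥-elim (¬ty (subst T πu≡πq tu))
    dominating⁺ T? dom (old v) ¬tv with dom v ¬tv
    ... | u , tu , uv = old u , tu , adj⇒adjᶜ uv (λ cut → ¬tv (subst T (Cut⇒same-class cut) tu))

    dominating⁻ : Dominating G⁺ (T ∘ π⁺) → Dominating G (T ∘ π)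
    dominating⁻ dom v ¬tv with dom (old v) ¬tv
    ... | w , tw , wv with collapse-adj w (old v) wv
    ...   | inj₁ w↦v = ⊥-elim (¬tv (subst T (trans (π⁺≡π∘collapse w) (cong π w↦v)) tw))
    ...   | inj₂ w↦∼v = collapse w , subst T (π⁺≡π∘collapse w) tw , w↦∼v

    connectedDominating⇔ : Decidable T →
      ConnectedDominating G (T ∘ π) ⇔ ConnectedDominating G⁺ (T ∘ π⁺)
    connectedDominating⇔ T? =
      mk⇔ (λ (dom , con) → dominating⁺ T? dom , connected⁺ con)
          (λ (dom , con) → dominating⁻ dom , connected⁻ con)

  partition⁺ : IsPartition G π → IsPartition G⁺ π⁺
  partition⁺ part i = let (v , πv≡i) = part i in old v , πv≡i

  N[x⁺]⊆P∪Q : ∀ u → Adj G⁺ x⁺ u → π⁺ u ≡ π p ⊎ π⁺ u ≡ π q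
  N[x⁺]⊆P∪Q y⁺ _ = inj₂ refl
  N[x⁺]⊆P∪Q (old v) e = inj₁ (InP⇒πp (from-does (inP? v) e))

  rung⁺ : Rung G⁺ π⁺
  rung⁺ = record
    { p = x⁺ ; p′ = old p′ ; q = y⁺ ; q′ = old q′
    ; isRung = record
      { p∼p′ = x⁺∼old (inj₂ refl) ; q∼q′ = y⁺∼old (inj₂ refl) ; p∼q = refl
      ; πp′≡πp = πp′≡πp ; πq′≡πq = πq′≡πq ; πp≢πq = πp≢πq
      ; N[p]⊆P∪Q = N[x⁺]⊆P∪Q
      }
    }

RungedRealisation : Graph → Set
RungedRealisation H = Σ (Realisation H) λ R → Rung (Realisation.G R) (Realisation.π R)

order : ∀ {H} → RungedRealisation H → ℕ
order (R , _) = n (Realisation.G R)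

ladder-step : ∀ {H} → RungedRealisation H → RungedRealisation H
ladder-step {H} (R , rung) = R⁺ , rung⁺
  where
  open Realisation R
  open Ladder G π rung
  R⁺ : Realisation H
  R⁺ = record
    { G = G⁺
    ; π = π⁺
    ; isRealisation = record
      { partition = partition⁺ partition
      ; deg≤3 = deg⁺≤3 deg≤3
      ; connected = connected⁺ connected
      ; coalition⇔adj = λ i j → coalition⇔adj i j ⇔-∘
          ⇔-sym (coalitions-transfer partition (partition⁺ partition) connectedDominating⇔ i j)
      }
    }

ladder : ∀ {H} → RungedRealisation H → ℕ → RungedRealisation H
ladder R zero = R
ladder R (suc t) = ladder-step (ladder R t)

order-ladder : ∀ {H} (R : RungedRealisation H) t → order (ladder R t) ≡ t * 2 + order R
order-ladder R zero = refl
order-ladder R (suc t) = cong (2 +_) (order-ladder R t)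

order-ladder-injective : ∀ {H} (R : RungedRealisation H) {s t} →
  order (ladder R s) ≡ order (ladder R t) → s ≡ t
order-ladder-injective R {s} {t} eq =
  *-cancelʳ-≡ s t 2 (+-cancelʳ-≡ (order R) (s * 2) (t * 2)
    (trans (sym (order-ladder R s)) (trans eq (order-ladder R t))))

infinitely-many : ∀ {H} → NoIsolatedVertex H → RungedRealisation H → InfinitelyManyRealise H
infinitely-many noIsolated R@(R₀ , rung) =
  (λ t → Realisation.G (proj₁ (ladder R t))) ,
  (λ t → realisation⇒ccp (Realisation.π R₀ (Rung.p rung)) noIsolated (proj₁ (ladder R t))) ,
  (λ s t s≢t (σ , _) → s≢t (order-ladder-injective R (↔⇒≡ σ)))

infinitely-many-from : (H G : Graph) (π : V G → V H) (p p′ q q′ : V G) →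
  {True (noIsolatedVertex? H)} → {True (isRealisation? H G π)} → {True (isRung? G π p p′ q q′)} →
  InfinitelyManyRealise H
infinitely-many-from H G π p p′ q q′ {noIsolated} {isRealisation} {isRung} =
  infinitely-many (toWitness noIsolated)
    (record { G = G ; π = π ; isRealisation = toWitness isRealisation } ,
     record { p = p ; p′ = p′ ; q = q ; q′ = q′ ; isRung = toWitness isRung })

G-c3 : Graph
G-c3 = fromEdges 5
  ( (# 0 , # 2) ∷ (# 0 , # 3) ∷ (# 1 , # 2) ∷ (# 1 , # 3) ∷ (# 1 , # 4) ∷ (# 3 , # 4) ∷ [])

π-c3 : V G-c3 → V C3
π-c3 = lookup (# 0 ∷ # 1 ∷ # 0 ∷ # 2 ∷ # 1 ∷ [])

G-2k2 : Graph
G-2k2 = fromEdges 7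
  ( (# 0 , # 1) ∷ (# 0 , # 3) ∷ (# 1 , # 2) ∷ (# 1 , # 6) ∷ (# 2 , # 4) ∷ (# 2 , # 5) ∷
    (# 3 , # 4) ∷ (# 3 , # 6) ∷ (# 4 , # 5) ∷ [])

π-2k2 : V G-2k2 → V TwoK2
π-2k2 = lookup (# 0 ∷ # 0 ∷ # 1 ∷ # 2 ∷ # 3 ∷ # 0 ∷ # 2 ∷ [])

G-p4 : Graph
G-p4 = fromEdges 6
  ( (# 0 , # 1) ∷ (# 0 , # 2) ∷ (# 0 , # 5) ∷ (# 1 , # 2) ∷ (# 1 , # 4) ∷ (# 2 , # 3) ∷
    (# 3 , # 4) ∷ (# 4 , # 5) ∷ [])

π-p4 : V G-p4 → V P4
π-p4 = lookup (# 1 ∷ # 1 ∷ # 0 ∷ # 3 ∷ # 2 ∷ # 2 ∷ [])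

G-c4 : Graph
G-c4 = fromEdges 7
  ( (# 0 , # 1) ∷ (# 0 , # 2) ∷ (# 0 , # 3) ∷ (# 1 , # 5) ∷ (# 1 , # 6) ∷ (# 2 , # 3) ∷
    (# 2 , # 5) ∷ (# 3 , # 6) ∷ (# 4 , # 5) ∷ (# 4 , # 6) ∷ [])

π-c4 : V G-c4 → V C4
π-c4 = lookup (# 0 ∷ # 0 ∷ # 2 ∷ # 2 ∷ # 0 ∷ # 1 ∷ # 3 ∷ [])

G-c3e : Graph
G-c3e = fromEdges 6
  ( (# 0 , # 1) ∷ (# 0 , # 2) ∷ (# 0 , # 5) ∷ (# 1 , # 2) ∷ (# 1 , # 4) ∷ (# 2 , # 3) ∷
    (# 3 , # 4) ∷ (# 4 , # 5) ∷ [])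

π-c3e : V G-c3e → V C3+e
π-c3e = lookup (# 1 ∷ # 3 ∷ # 2 ∷ # 2 ∷ # 0 ∷ # 0 ∷ [])

G-k4e : Graph
G-k4e = fromEdges 6
  ( (# 0 , # 1) ∷ (# 0 , # 2) ∷ (# 0 , # 5) ∷ (# 1 , # 2) ∷ (# 1 , # 4) ∷ (# 2 , # 3) ∷
    (# 3 , # 4) ∷ (# 4 , # 5) ∷ [])

π-k4e : V G-k4e → V K4-e
π-k4e = lookup (# 0 ∷ # 2 ∷ # 0 ∷ # 1 ∷ # 1 ∷ # 3 ∷ [])

G-p2p3 : Graph
G-p2p3 = fromEdges 9
  ( (# 0 , # 3) ∷ (# 0 , # 5) ∷ (# 0 , # 7) ∷ (# 1 , # 6) ∷ (# 1 , # 8) ∷ (# 2 , # 3) ∷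
    (# 2 , # 5) ∷ (# 2 , # 7) ∷ (# 3 , # 4) ∷ (# 4 , # 6) ∷ (# 4 , # 8) ∷ (# 5 , # 8) ∷
    (# 6 , # 7) ∷ [])

π-p2p3 : V G-p2p3 → V P2∪P3
π-p2p3 = lookup (# 0 ∷ # 0 ∷ # 3 ∷ # 2 ∷ # 3 ∷ # 4 ∷ # 0 ∷ # 1 ∷ # 3 ∷ [])

G-s12 : Graph
G-s12 = fromEdges 7
  ( (# 0 , # 1) ∷ (# 0 , # 3) ∷ (# 0 , # 6) ∷ (# 1 , # 4) ∷ (# 2 , # 3) ∷ (# 2 , # 6) ∷
    (# 3 , # 5) ∷ (# 4 , # 5) ∷ (# 4 , # 6) ∷ [])

π-s12 : V G-s12 → V S12
π-s12 = lookup (# 3 ∷ # 3 ∷ # 1 ∷ # 4 ∷ # 0 ∷ # 2 ∷ # 0 ∷ [])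

G-p5 : Graph
G-p5 = fromEdges 10
  ( (# 0 , # 1) ∷ (# 0 , # 3) ∷ (# 0 , # 8) ∷ (# 1 , # 2) ∷ (# 1 , # 4) ∷ (# 2 , # 5) ∷
    (# 2 , # 7) ∷ (# 3 , # 4) ∷ (# 3 , # 8) ∷ (# 4 , # 5) ∷ (# 5 , # 6) ∷ (# 6 , # 7) ∷
    (# 6 , # 9) ∷ (# 7 , # 9) ∷ (# 8 , # 9) ∷ [])

π-p5 : V G-p5 → V P5
π-p5 = lookup (# 1 ∷ # 1 ∷ # 1 ∷ # 3 ∷ # 3 ∷ # 3 ∷ # 4 ∷ # 0 ∷ # 2 ∷ # 2 ∷ [])

G-c3ee : Graph
G-c3ee = fromEdges 9
  ( (# 0 , # 1) ∷ (# 0 , # 4) ∷ (# 1 , # 7) ∷ (# 1 , # 8) ∷ (# 2 , # 5) ∷ (# 2 , # 7) ∷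
    (# 2 , # 8) ∷ (# 3 , # 5) ∷ (# 3 , # 6) ∷ (# 3 , # 8) ∷ (# 4 , # 5) ∷ (# 4 , # 6) ∷ [])

π-c3ee : V G-c3ee → V C3+e+e
π-c3ee = lookup (# 2 ∷ # 0 ∷ # 1 ∷ # 0 ∷ # 1 ∷ # 1 ∷ # 3 ∷ # 4 ∷ # 0 ∷ [])

G-c4e : Graph
G-c4e = fromEdges 9
  ( (# 0 , # 3) ∷ (# 0 , # 4) ∷ (# 0 , # 6) ∷ (# 1 , # 2) ∷ (# 1 , # 5) ∷ (# 1 , # 7) ∷
    (# 2 , # 6) ∷ (# 3 , # 5) ∷ (# 3 , # 7) ∷ (# 4 , # 5) ∷ (# 4 , # 8) ∷ (# 6 , # 8) ∷
    (# 7 , # 8) ∷ [])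

π-c4e : V G-c4e → V C4+e
π-c4e = lookup (# 0 ∷ # 2 ∷ # 4 ∷ # 0 ∷ # 2 ∷ # 1 ∷ # 0 ∷ # 3 ∷ # 2 ∷ [])

G-c32e : Graph
G-c32e = fromEdges 14
  ( (# 0 , # 1) ∷ (# 0 , # 3) ∷ (# 0 , # 13) ∷ (# 1 , # 2) ∷ (# 1 , # 4) ∷ (# 2 , # 5) ∷
    (# 2 , # 9) ∷ (# 3 , # 4) ∷ (# 3 , # 7) ∷ (# 4 , # 5) ∷ (# 5 , # 12) ∷ (# 6 , # 7) ∷
    (# 6 , # 9) ∷ (# 6 , # 10) ∷ (# 7 , # 8) ∷ (# 8 , # 9) ∷ (# 8 , # 13) ∷ (# 10 , # 11) ∷
    (# 10 , # 12) ∷ (# 11 , # 12) ∷ (# 11 , # 13) ∷ [])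

π-c32e : V G-c32e → V C3+2e
π-c32e = lookup (# 0 ∷ # 0 ∷ # 0 ∷ # 1 ∷ # 1 ∷ # 1 ∷ # 0 ∷ # 2 ∷ # 2 ∷ # 4 ∷ # 0 ∷ # 3 ∷ # 1 ∷ # 0 ∷ [])

G-s22 : Graph
G-s22 = fromEdges 16
  ( (# 0 , # 1) ∷ (# 0 , # 3) ∷ (# 0 , # 8) ∷ (# 1 , # 2) ∷ (# 1 , # 4) ∷ (# 2 , # 5) ∷
    (# 2 , # 12) ∷ (# 3 , # 4) ∷ (# 3 , # 14) ∷ (# 4 , # 5) ∷ (# 5 , # 15) ∷ (# 6 , # 7) ∷
    (# 6 , # 11) ∷ (# 6 , # 13) ∷ (# 7 , # 8) ∷ (# 7 , # 14) ∷ (# 8 , # 9) ∷ (# 9 , # 11) ∷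
    (# 9 , # 15) ∷ (# 10 , # 11) ∷ (# 10 , # 13) ∷ (# 10 , # 15) ∷ (# 12 , # 13) ∷ (# 12 , # 14) ∷ [])

π-s22 : V G-s22 → V S22
π-s22 = lookup
  (# 0 ∷ # 0 ∷ # 0 ∷ # 1 ∷ # 1 ∷ # 1 ∷ # 5 ∷ # 1 ∷ # 0 ∷ # 0 ∷ # 4 ∷ # 3 ∷ # 0 ∷ # 2 ∷ # 1 ∷ # 1 ∷ [])

named : ∀ h → InfinitelyManyRealise (graphOf h)
named c3 = infinitely-many-from C3 G-c3 π-c3 (# 2) (# 0) (# 1) (# 4)
named twoK2 = infinitely-many-from TwoK2 G-2k2 π-2k2 (# 0) (# 1) (# 3) (# 6)
named p4 = infinitely-many-from P4 G-p4 π-p4 (# 5) (# 4) (# 0) (# 1)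
named c4 = infinitely-many-from C4 G-c4 π-c4 (# 0) (# 1) (# 2) (# 3)
named c3+e = infinitely-many-from C3+e G-c3e π-c3e (# 3) (# 2) (# 4) (# 5)
named k4-e = infinitely-many-from K4-e G-k4e π-k4e (# 3) (# 4) (# 2) (# 0)
named p2∪p3 = infinitely-many-from P2∪P3 G-p2p3 π-p2p3 (# 1) (# 6) (# 8) (# 4)
named s12 = infinitely-many-from S12 G-s12 π-s12 (# 1) (# 0) (# 4) (# 6)
named p5 = infinitely-many-from P5 G-p5 π-p5 (# 1) (# 0) (# 4) (# 3)
named c3+e+e = infinitely-many-from C3+e+e G-c3ee π-c3ee (# 5) (# 2) (# 3) (# 8)
named c4+e = infinitely-many-from C4+e G-c4e π-c4e (# 0) (# 3) (# 4) (# 8)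
named c3+2e = infinitely-many-from C3+2e G-c32e π-c32e (# 0) (# 1) (# 3) (# 4)
named s22 = infinitely-many-from S22 G-s22 π-s22 (# 0) (# 1) (# 3) (# 4)

-- Stars

-- Class zero is the centre A of the star; it is dominating and splits into two connected
-- halves, according to side, which the leaf classes join.
record StarFrame (L : ℕ) : Set where
  field
    G : Graph
    π : V G → Fin (2 + L)
    partition : IsPartition G π
    deg≤3 : ∀ v → deg G v ≤ 3
    a a′ b b′ : V G
    a∼a′ : Adj G a a′
    b∼b′ : Adj G b b′
    πa≡0 : π a ≡ zero
    πb≡0 : π b ≡ zero
    πb′≡0 : π b′ ≡ zero
    N[a]⊆A : ∀ u → Adj G a u → π u ≡ zero
    side : V G → Bool
    side-a : side a ≡ true
    side-b : side b ≡ false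
    side-A-edge : ∀ u v → π u ≡ zero → π v ≡ zero → Adj G u v → side u ≡ side v
    half-connected : ∀ s → InducedConnected G (λ v → π v ≡ zero × side v ≡ s)
    A-dominating : Dominating G (Class G π zero)
    A∪B-cds : ∀ i → ConnectedDominating G (λ v → π v ≡ zero ⊎ π v ≡ suc i)
    rung : Rung G π
    rung-clear : ¬ TwoEdgeCut.Endpoint G a a′ b b′ (Rung.p rung)
               × ¬ TwoEdgeCut.Endpoint G a a′ b b′ (Rung.q rung)

-- The edges a a′ and b b′ of A are subdivided by new centre vertices X and Y, and a new
-- leaf class {W} is attached to both; W bridges the two halves of A.
module StarStep {L : ℕ} (F : StarFrame L) where
  open StarFrame F
  open Rung rung
  open TwoEdgeCut G a a′ b b′
    renaming (InP to InA; InQ to InB; inP? to inA?; inQ? to inB?)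

  pattern X = zero
  pattern Y = suc zero
  pattern W = suc (suc zero)
  pattern old v = suc (suc (suc v))

  adj⁺ : Fin (3 + n G) → Fin (3 + n G) → Bool
  adj⁺ X X = false
  adj⁺ X Y = false
  adj⁺ X W = true
  adj⁺ X (old v) = does (inA? v)
  adj⁺ Y X = false
  adj⁺ Y Y = false
  adj⁺ Y W = true
  adj⁺ Y (old v) = does (inB? v)
  adj⁺ W X = true
  adj⁺ W Y = true
  adj⁺ W W = false
  adj⁺ W (old v) = false
  adj⁺ (old u) X = does (inA? u)
  adj⁺ (old u) Y = does (inB? u)
  adj⁺ (old u) W = false
  adj⁺ (old u) (old v) = adjᶜ u v

  adj⁺-sym : ∀ u v → adj⁺ u v ≡ adj⁺ v u
  adj⁺-sym X X = refl
  adj⁺-sym X Y = refl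
  adj⁺-sym X W = refl
  adj⁺-sym X (old v) = refl
  adj⁺-sym Y X = refl
  adj⁺-sym Y Y = refl
  adj⁺-sym Y W = refl
  adj⁺-sym Y (old v) = refl
  adj⁺-sym W X = refl
  adj⁺-sym W Y = refl
  adj⁺-sym W W = refl
  adj⁺-sym W (old v) = refl
  adj⁺-sym (old u) X = refl
  adj⁺-sym (old u) Y = refl
  adj⁺-sym (old u) W = refl
  adj⁺-sym (old u) (old v) = adjᶜ-sym u v

  adj⁺-irr : ∀ v → adj⁺ v v ≡ false
  adj⁺-irr X = refl
  adj⁺-irr Y = refl
  adj⁺-irr W = refl
  adj⁺-irr (old v) = adjᶜ-irr v

  G⁺ : Graph
  G⁺ = record { n = 3 + n G ; adj = adj⁺ ; adj-sym = adj⁺-sym ; adj-irr = adj⁺-irr }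

  π⁺ : V G⁺ → Fin (3 + L)
  π⁺ X = zero
  π⁺ Y = zero
  π⁺ W = fromℕ (2 + L)
  π⁺ (old v) = inject₁ (π v)

  old-injective : ∀ {u v : V G} → _≡_ {A = V G⁺} (old u) (old v) → u ≡ v
  old-injective refl = refl

  inject₁≡0 : ∀ {m} {i : Fin (suc m)} → inject₁ i ≡ zero → i ≡ zero
  inject₁≡0 = inject₁-injective

  πa′≡0 : π a′ ≡ zero
  πa′≡0 = N[a]⊆A a′ a∼a′

  InA⇒A : ∀ {v} → InA v → π v ≡ zero
  InA⇒A (inj₁ refl) = πa≡0
  InA⇒A (inj₂ refl) = πa′≡0

  InB⇒A : ∀ {v} → InB v → π v ≡ zero
  InB⇒A (inj₁ refl) = πb≡0
  InB⇒A (inj₂ refl) = πb′≡0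

  Endpoint⇒A : ∀ {v} → Endpoint v → π v ≡ zero
  Endpoint⇒A (inj₁ v∈A) = InA⇒A v∈A
  Endpoint⇒A (inj₂ v∈B) = InB⇒A v∈B

  InA⇒side : ∀ {v} → InA v → side v ≡ true
  InA⇒side (inj₁ refl) = side-a
  InA⇒side (inj₂ refl) = trans (sym (side-A-edge a a′ πa≡0 πa′≡0 a∼a′)) side-a

  InB⇒side : ∀ {v} → InB v → side v ≡ false
  InB⇒side (inj₁ refl) = side-b
  InB⇒side (inj₂ refl) = trans (sym (side-A-edge b b′ πb≡0 πb′≡0 b∼b′)) side-b

  X∼old : ∀ {v} → InA v → Adj G⁺ X (old v)
  X∼old {v} v∈A = dec-true (inA? v) v∈A

  Y∼old : ∀ {v} → InB v → Adj G⁺ Y (old v)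
  Y∼old {v} v∈B = dec-true (inB? v) v∈B

  InA∩InB≡∅ : ∀ {v} → InA v → InB v → ⊥
  InA∩InB≡∅ v∈A v∈B with () ← trans (sym (InA⇒side v∈A)) (InB⇒side v∈B)

  open Degrees a∼a′ b∼b′ InA∩InB≡∅
  open Lifting G⁺ (λ v → old v) X Y X∼old Y∼old id

  deg⁺≤3 : ∀ v → deg G⁺ v ≤ 3
  deg⁺≤3 v rewrite deg≡count G⁺ v = row≤3 v
    where
    row≤3 : ∀ v → count (adj⁺ v) ≤ 3
    row≤3 X = s≤s (count-pair a a′)
    row≤3 Y = s≤s (count-pair b b′)
    row≤3 W rewrite count-false (n G) = s≤s (s≤s z≤n)
    row≤3 (old v) = ≤-trans (count-adjᶜ v) (subst (_≤ 3) (deg≡count G v) (deg≤3 v))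

  partition⁺ : IsPartition G⁺ π⁺
  partition⁺ j with view j
  ... | ‵fromℕ = W , refl
  ... | ‵inject₁ i = let (v , πv≡i) = partition i in old v , cong inject₁ πv≡i

  N[a]⊆A⁺ : ∀ u → Adj G⁺ (old a) u → π⁺ u ≡ zero
  N[a]⊆A⁺ X _ = refl
  N[a]⊆A⁺ Y _ = refl
  N[a]⊆A⁺ (old u) au = cong inject₁ (N[a]⊆A u (adjᶜ⇒adj a u au))

  side⁺ : V G⁺ → Bool
  side⁺ X = true
  side⁺ Y = false
  side⁺ W = false
  side⁺ (old v) = side v

  side-A-edge⁺ : ∀ u v → π⁺ u ≡ zero → π⁺ v ≡ zero → Adj G⁺ u v → side⁺ u ≡ side⁺ v
  side-A-edge⁺ X (old v) _ _ e = sym (InA⇒side (from-does (inA? v) e))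
  side-A-edge⁺ Y (old v) _ _ e = sym (InB⇒side (from-does (inB? v) e))
  side-A-edge⁺ (old u) X _ _ e = InA⇒side (from-does (inA? u) e)
  side-A-edge⁺ (old u) Y _ _ e = InB⇒side (from-does (inB? u) e)
  side-A-edge⁺ (old u) (old v) πu πv e = side-A-edge u v (inject₁≡0 πu) (inject₁≡0 πv) (adjᶜ⇒adj u v e)

  Half : Bool → VSet G
  Half s v = π v ≡ zero × side v ≡ s

  Half⁺ : Bool → VSet G⁺
  Half⁺ s w = π⁺ w ≡ zero × side⁺ w ≡ s

  module _ {s : Bool} where

    old-half : ∀ {v} → Half s v → Half⁺ s (old v)
    old-half (πv , sv) = cong inject₁ πv , sv

    X-half : ∀ {v} → Half s v → InA v → Half⁺ s X
    X-half (_ , sv) v∈A = refl , trans (sym (InA⇒side v∈A)) sv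

    Y-half : ∀ {v} → Half s v → InB v → Half⁺ s Y
    Y-half (_ , sv) v∈B = refl , trans (sym (InB⇒side v∈B)) sv

    half-to-old : ∀ {w} → Half⁺ s w → ∃ λ v → Half s v × WalkIn G⁺ (Half⁺ s) w (old v)
    half-to-old {X} hX@(_ , refl) =
      a , (πa≡0 , side-a) , step {w = old a} hX (X∼old (inj₁ refl)) (here (cong inject₁ πa≡0 , side-a))
    half-to-old {Y} hY@(_ , refl) =
      b , (πb≡0 , side-b) , step {w = old b} hY (Y∼old (inj₁ refl)) (here (cong inject₁ πb≡0 , side-b))
    half-to-old {old v} (πv , sv) = v , (inject₁≡0 πv , sv) , here (πv , sv)

  half-connected⁺ : ∀ s → InducedConnected G⁺ (Half⁺ s)
  half-connected⁺ s u v hu hv with half-to-old hu | half-to-old hv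
  ... | u′ , hu′ , u↝u′ | v′ , hv′ , v↝v′ =
    walk-++ u↝u′ (walk-++ (lift-walk old-half X-half Y-half (half-connected s u′ v′ hu′ hv′))
                          (walk-reverse v↝v′))

  Cut⇒A : ∀ {u v} → Cut u v → π v ≡ zero
  Cut⇒A cut = Endpoint⇒A (Cut⇒Endpoint (Cut-sym cut))

  A-dominating⁺ : Dominating G⁺ (Class G⁺ π⁺ zero)
  A-dominating⁺ X ¬A = ⊥-elim (¬A refl)
  A-dominating⁺ Y ¬A = ⊥-elim (¬A refl)
  A-dominating⁺ W _ = X , refl , refl
  A-dominating⁺ (old v) ¬A with A-dominating v (¬A ∘ cong inject₁)
  ... | u , πu , uv = old u , cong inject₁ πu , adj⇒adjᶜ uv (¬A ∘ cong inject₁ ∘ Cut⇒A)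

  A-reaches-a-or-b : ∀ {v} → π v ≡ zero →
    WalkIn G (Class G π zero) v a ⊎ WalkIn G (Class G π zero) v b
  A-reaches-a-or-b {v} πv with side v in sv
  ... | true = inj₁ (walk-mono proj₁ (half-connected true v a (πv , sv) (πa≡0 , side-a)))
  ... | false = inj₂ (walk-mono proj₁ (half-connected false v b (πv , sv) (πb≡0 , side-b)))

  module _ {S′ : VSet G⁺} (A⁺⊆S′ : ∀ {w} → π⁺ w ≡ zero → S′ w) where

    lift-walk-over-A : ∀ {S : VSet G} → (∀ {v} → S v → S′ (old v)) →
      ∀ {u v} → WalkIn G S u v → WalkIn G⁺ S′ (old u) (old v)
    lift-walk-over-A S⇒S′ = lift-walk S⇒S′ (λ _ _ → A⁺⊆S′ refl) (λ _ _ → A⁺⊆S′ refl)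

    X↝a : WalkIn G⁺ S′ X (old a)
    X↝a = step {w = old a} (A⁺⊆S′ refl) (X∼old (inj₁ refl)) (here (A⁺⊆S′ (cong inject₁ πa≡0)))

    Y↝b : WalkIn G⁺ S′ Y (old b)
    Y↝b = step {w = old b} (A⁺⊆S′ refl) (Y∼old (inj₁ refl)) (here (A⁺⊆S′ (cong inject₁ πb≡0)))

  A∪B⁺ : Fin (2 + L) → VSet G⁺
  A∪B⁺ j w = π⁺ w ≡ zero ⊎ π⁺ w ≡ suc j

  A∪W-connected : InducedConnected G⁺ (A∪B⁺ (fromℕ (suc L)))
  A∪W-connected = connected-via-hub G⁺ (old a) ↝a
    where
    W↝a : WalkIn G⁺ (A∪B⁺ (fromℕ (suc L))) W (old a)
    W↝a = step {w = X} (inj₂ refl) refl (X↝a inj₁)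
    Y↝a : WalkIn G⁺ (A∪B⁺ (fromℕ (suc L))) Y (old a)
    Y↝a = step {w = W} (inj₁ refl) refl W↝a
    ↝a : ∀ {w} → A∪B⁺ (fromℕ (suc L)) w → WalkIn G⁺ (A∪B⁺ (fromℕ (suc L))) w (old a)
    ↝a {X} _ = X↝a inj₁
    ↝a {Y} _ = Y↝a
    ↝a {W} _ = W↝a
    ↝a {old v} (inj₂ πv≡new) = ⊥-elim (fromℕ≢inject₁ (sym πv≡new))
    ↝a {old v} (inj₁ πv) with A-reaches-a-or-b (inject₁≡0 πv)
    ... | inj₁ v↝a = lift-walk-over-A inj₁ (inj₁ ∘ cong inject₁) v↝a
    ... | inj₂ v↝b = walk-++ (lift-walk-over-A inj₁ (inj₁ ∘ cong inject₁) v↝b)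
                             (step {w = Y} (inj₁ (cong inject₁ πb≡0))
                                   (Adj-sym G⁺ {Y} {old b} (Y∼old (inj₁ refl))) Y↝a)

  A∪B-connected : ∀ i → InducedConnected G⁺ (A∪B⁺ (inject₁ i))
  A∪B-connected i = connected-via-hub G⁺ (old a) ↝a
    where
    S : VSet G
    S v = π v ≡ zero ⊎ π v ≡ suc i
    S⇒S⁺ : ∀ {v} → S v → A∪B⁺ (inject₁ i) (old v)
    S⇒S⁺ (inj₁ πv) = inj₁ (cong inject₁ πv)
    S⇒S⁺ (inj₂ πv) = inj₂ (cong inject₁ πv)
    S⁺⇒S : ∀ {v} → A∪B⁺ (inject₁ i) (old v) → S v
    S⁺⇒S (inj₁ πv) = inj₁ (inject₁≡0 πv)
    S⁺⇒S (inj₂ πv) = inj₂ (inject₁-injective πv)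
    ↝a : ∀ {w} → A∪B⁺ (inject₁ i) w → WalkIn G⁺ (A∪B⁺ (inject₁ i)) w (old a)
    ↝a {X} _ = X↝a inj₁
    ↝a {Y} _ = walk-++ (Y↝b inj₁)
      (lift-walk-over-A inj₁ S⇒S⁺ (proj₂ (A∪B-cds i) b a (inj₁ πb≡0) (inj₁ πa≡0)))
    ↝a {W} (inj₂ new≡old) = ⊥-elim (fromℕ≢inject₁ (suc-injective new≡old))
    ↝a {old v} sv = lift-walk-over-A inj₁ S⇒S⁺ (proj₂ (A∪B-cds i) v a (S⁺⇒S sv) (inj₁ πa≡0))

  A∪B-cds⁺ : ∀ j → ConnectedDominating G⁺ (A∪B⁺ j)
  A∪B-cds⁺ j = dominating-mono G⁺ inj₁ A-dominating⁺ , connected j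
    where
    connected : ∀ j → InducedConnected G⁺ (A∪B⁺ j)
    connected j with view j
    ... | ‵fromℕ = A∪W-connected
    ... | ‵inject₁ i = A∪B-connected i

  p-clear : ¬ Endpoint p
  p-clear = proj₁ rung-clear

  q-clear : ¬ Endpoint q
  q-clear = proj₂ rung-clear

  N[p]⁺ : ∀ u → Adj G⁺ (old p) u → π⁺ u ≡ π⁺ (old p) ⊎ π⁺ u ≡ π⁺ (old q)
  N[p]⁺ X e = ⊥-elim (p-clear (inj₁ (from-does (inA? p) e)))
  N[p]⁺ Y e = ⊥-elim (p-clear (inj₂ (from-does (inB? p) e)))
  N[p]⁺ (old u) e with N[p]⊆P∪Q u (adjᶜ⇒adj p u e)
  ... | inj₁ πu≡πp = inj₁ (cong inject₁ πu≡πp)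
  ... | inj₂ πu≡πq = inj₂ (cong inject₁ πu≡πq)

  rung⁺ : Rung G⁺ π⁺
  rung⁺ = record
    { p = old p ; p′ = old p′ ; q = old q ; q′ = old q′
    ; isRung = record
      { p∼p′ = adj⇒adjᶜ p∼p′ (p-clear ∘ Cut⇒Endpoint)
      ; q∼q′ = adj⇒adjᶜ q∼q′ (q-clear ∘ Cut⇒Endpoint)
      ; p∼q = adj⇒adjᶜ p∼q (p-clear ∘ Cut⇒Endpoint)
      ; πp′≡πp = cong inject₁ πp′≡πp
      ; πq′≡πq = cong inject₁ πq′≡πq
      ; πp≢πq = πp≢πq ∘ inject₁-injective
      ; N[p]⊆P∪Q = N[p]⁺
      }
    }

  clear⁺ : ∀ {v} → ¬ Endpoint v → ¬ TwoEdgeCut.Endpoint G⁺ (old a) X (old b) Y (old v)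
  clear⁺ v-clear (inj₁ (inj₁ v≡a)) = v-clear (inj₁ (inj₁ (old-injective v≡a)))
  clear⁺ v-clear (inj₂ (inj₁ v≡b)) = v-clear (inj₂ (inj₁ (old-injective v≡b)))

  frame⁺ : StarFrame (suc L)
  frame⁺ = record
    { G = G⁺
    ; π = π⁺
    ; partition = partition⁺
    ; deg≤3 = deg⁺≤3
    ; a = old a ; a′ = X ; b = old b ; b′ = Y
    ; a∼a′ = Adj-sym G⁺ {X} {old a} (X∼old (inj₁ refl))
    ; b∼b′ = Adj-sym G⁺ {Y} {old b} (Y∼old (inj₁ refl))
    ; πa≡0 = cong inject₁ πa≡0
    ; πb≡0 = cong inject₁ πb≡0
    ; πb′≡0 = refl
    ; N[a]⊆A = N[a]⊆A⁺
    ; side = side⁺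
    ; side-a = side-a
    ; side-b = side-b
    ; side-A-edge = side-A-edge⁺
    ; half-connected = half-connected⁺
    ; A-dominating = A-dominating⁺
    ; A∪B-cds = A∪B-cds⁺
    ; rung = rung⁺
    ; rung-clear = clear⁺ p-clear , clear⁺ q-clear
    }

module FrameRealisation {L : ℕ} (F : StarFrame L) where
  open StarFrame F

  side-walk : ∀ {u v} → WalkIn G (Class G π zero) u v → side u ≡ side v
  side-walk (here _) = refl
  side-walk (step πu uw walk) = trans (side-A-edge _ _ πu (walk-start walk) uw) (side-walk walk)

  A-disconnected : ¬ InducedConnected G (Class G π zero)
  A-disconnected con with () ← trans (sym side-a) (trans (side-walk (con a b πa≡0 πb≡0)) side-b)

  -- The vertex a and all its neighbours lie in A.
  leaves-miss-a : ∀ {T : Fin (2 + L) → Set} → ¬ T zero → ¬ Dominating G (T ∘ π)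
  leaves-miss-a {T} ¬T0 dom with dom a (¬T0 ∘ subst T πa≡0)
  ... | u , tu , ua = ¬T0 (subst T (N[a]⊆A u (Adj-sym G ua)) tu)

  classes-disjoint : ∀ {i j} → i ≢ j → Disjoint {G} (Class G π i) (Class G π j)
  classes-disjoint {i} {j} = from (classes-disjoint⇔ G partition i j)

  coalition⇔adj : ∀ i j → ConnCoalition G (Class G π i) (Class G π j) ⇔ Adj (Star (2 + L)) i j
  coalition⇔adj zero zero = mk⇔ (λ (disj , _) → ⊥-elim (disj a πa≡0 πa≡0)) (λ ())
  coalition⇔adj zero (suc j) = mk⇔ (λ _ → refl) λ _ →
    classes-disjoint (λ ()) , A-disconnected ∘ proj₂ ,
    leaves-miss-a {λ c → c ≡ suc j} (λ ()) ∘ proj₁ , A∪B-cds j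
  coalition⇔adj (suc i) zero = mk⇔ (λ _ → refl) λ _ →
    classes-disjoint (λ ()) , leaves-miss-a {λ c → c ≡ suc i} (λ ()) ∘ proj₁ ,
    A-disconnected ∘ proj₂ , connectedDominating-resp G swap swap (A∪B-cds i)
  coalition⇔adj (suc i) (suc j) = mk⇔
    (λ (_ , _ , _ , cds) →
       ⊥-elim (leaves-miss-a {λ c → c ≡ suc i ⊎ c ≡ suc j} [ (λ ()) , (λ ()) ] (proj₁ cds)))
    (λ ())

  runged : RungedRealisation (Star (2 + L))
  runged = record
    { G = G
    ; π = π
    ; isRealisation = record
      { partition = partition
      ; deg≤3 = deg≤3
      ; connected =
          connectedDominating⇒connected G (λ v → π v ≟ zero ⊎-dec π v ≟ suc zero) (A∪B-cds zero)
      ; coalition⇔adj = coalition⇔adj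
      }
    } , rung

path₈ : Graph
path₈ = fromEdges 8
  ( (# 0 , # 1) ∷ (# 1 , # 2) ∷ (# 2 , # 3) ∷ (# 3 , # 4) ∷ (# 4 , # 5) ∷ (# 5 , # 6) ∷
    (# 6 , # 7) ∷ [])

star-base : StarFrame 0
star-base = record
  { G = path₈
  ; π = π
  ; partition = from-yes (all? λ i → any? λ v → π v ≟ i)
  ; deg≤3 = from-yes (all? λ v → deg path₈ v ≤? 3)
  ; a = # 0 ; a′ = # 1 ; b = # 7 ; b′ = # 6
  ; a∼a′ = refl ; b∼b′ = refl
  ; πa≡0 = refl ; πb≡0 = refl ; πb′≡0 = refl
  ; N[a]⊆A = from-yes (all? λ u → Adj? path₈ (# 0) u →-dec π u ≟ zero)
  ; side = side
  ; side-a = refl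
  ; side-b = refl
  ; side-A-edge = from-yes (all? λ u → all? λ v →
      π u ≟ zero →-dec π v ≟ zero →-dec Adj? path₈ u v →-dec side u Bool.≟ side v)
  ; half-connected = λ
      { true → from-yes (connected? path₈ λ v → π v ≟ zero ×-dec side v Bool.≟ true)
      ; false → from-yes (connected? path₈ λ v → π v ≟ zero ×-dec side v Bool.≟ false)
      }
  ; A-dominating = from-yes (dominating? path₈ λ v → π v ≟ zero)
  ; A∪B-cds = λ { zero → from-yes (connectedDominating? path₈ λ v → π v ≟ zero ⊎-dec π v ≟ suc zero) }
  ; rung = record
    { p = # 2 ; p′ = # 1 ; q = # 3 ; q′ = # 4
    ; isRung = from-yes (isRung? path₈ π (# 2) (# 1) (# 3) (# 4))
    }
  ; rung-clear = from-yes (¬? (endpoint? (# 2)) ×-dec ¬? (endpoint? (# 3)))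
  }
  where
  π : Fin 8 → Fin 2
  π = lookup (# 0 ∷ # 0 ∷ # 0 ∷ # 1 ∷ # 1 ∷ # 0 ∷ # 0 ∷ # 0 ∷ [])
  side : Fin 8 → Bool
  side = lookup (true ∷ true ∷ true ∷ false ∷ false ∷ false ∷ false ∷ false ∷ [])
  open TwoEdgeCut path₈ (# 0) (# 1) (# 7) (# 6)

star-frame : ∀ L → StarFrame L
star-frame zero = star-base
star-frame (suc L) = StarStep.frame⁺ (star-frame L)

star-no-isolated : ∀ L → NoIsolatedVertex (Star (2 + L))
star-no-isolated L zero = suc zero , refl
star-no-isolated L (suc i) = zero , refl

stars : ∀ k → 2 ≤ k → InfinitelyManyRealise (Star k)
stars (suc (suc L)) (s≤s (s≤s z≤n)) =
  infinitely-many (star-no-isolated L) (FrameRealisation.runged (star-frame L))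

proposition2 : (∀ (h : NamedH) → InfinitelyManyRealise (graphOf h))
    × (∀ (k : ℕ) → 2 ≤ k → InfinitelyManyRealise (Star k))
proposition2 = named , stars
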